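{- Let $\bar T$ be the output of Algorithm 1 on $G$. For every $i\ge0$, every edge $e\in\bar T^i\setminus E_{F^i}$ is essential in the multigraph $(V^i,\bar T^i\cup E_{F^i})$, i.e., removing $e$ from this multigraph leaves a graph that is not 2-edge-connected.
   Context: A multigraph is 2-edge-connected if removing any single edge leaves it connected. Input: a 2-edge-connected undirected multigraph $G=(V,E)$ (parallel edges allowed, edges identified by name), edge costs $c\colon E\to\mathbb{R}_{\ge0}$. Algorithm 1: Maintain a multigraph $G'=(V',E')$, initially a copy of $G$, with costs $c':=c$; an edge set $T:=\varnothing$; and a forest $F=(V',\varnothing)$ on the same node set (edges keep their names when endpoints are contracted). Grow phase: while $F$ has more than one node: let $L$ be the set of nodes of degree at most $1$ in $F$; for $e\in E'$ let $\ell_e$ be the number of endpoints of $e$ lying in $L$; $e$ is eligible if $e\notin T$ and $\ell_e\ge1$, with $\Delta(e):=c'(e)/\ell_e$; choose an eligible $\tilde e$ minimizing $\Delta$, $\tilde\Delta:=\Delta(\tilde e)$; decrease $c'(e)$ by $\ell_e\tilde\Delta$ for each eligible $e$; add $\tilde e$ to $F$ and $T$; if $\tilde e$ closes a cycle $Q$ in $F$, contract $Q$ into one node in $F$ and $G'$, removing self-loops. Cleanup phase: go through the edges $e$ of $T$ in reverse order of insertion; if $(V,T\setminus\{e\})$ is 2-edge-connected, remove $e$ from $T$. The output is $\bar T:=T$. Notation: $F^i=(V^i,E_{F^i})$ is the forest after the $i$-th grow step; its node set $V^i$ corresponds to a partition of $V$. $\bar T^i$ denotes the set of edges of $\bar T$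 whose two endpoints lie in different parts of this partition, regarded as edges of a multigraph on node set $V^i$ (edges of $\bar T$ that would become self-loops are dropped).
   Formalization: The edge costs $c$ are nonnegative rationals rather than nonnegative reals. -}

module Defs where

open import Data.Nat as ℕ using (ℕ; zero; suc)
open import Data.Fin using (Fin)
open import Data.Fin.Properties using () renaming (_≟_ to _≟ᶠ_)
open import Data.Integer using (+_)
open import Data.Rational as ℚ using (ℚ; 0ℚ; _/_)
open import Data.Product using (Σ; ∃; ∃-syntax; _×_; _,_; proj₁; proj₂)
open import Data.Sum using (_⊎_)
open import Data.Bool using (Bool; true; false; if_then_else_)
open import Data.List using (List; []; _∷_; filter; length)
open import Data.List.Membership.Propositional using (_∈_; _∉_)
open import Relation.Nullary using (¬_; Dec; yes; no; _×-dec_; _⊎-dec_; ¬?)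

open import Relation.Binary.PropositionalEquality using (_≡_; _≢_)
open import Relation.Binary.Construct.Closure.ReflexiveTransitive using (Star)

-- Input multigraph: node set V = Fin n, edge names E = Fin m,
-- each edge named e has endpoints ends e (an unordered pair; the order
-- of the two components is irrelevant in everything below).

record Multigraph : Set where
  field
    n    : ℕ
    m    : ℕ
    ends : Fin m → Fin n × Fin n

module _ (G : Multigraph) where
  open Multigraph G

  V : Set
  V = Fin n

  E : Set
  E = Fin m

  src tgt : E → V
  src e = proj₁ (ends e)
  tgt e = proj₂ (ends e)

  Loopless : Set
  Loopless = ∀ e → src e ≢ tgt e

  -- A partition of V is given by a labelling  part : V → V ; two nodes
  -- are in the same part iff they have the same label.  The node set of
  -- the contracted multigraph is the set of labels  part x  (x ∈ V);
  -- an edge e joins the nodes  part (src e)  and  part (tgt e).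

  EdgeSet : Set₁
  EdgeSet = E → Set

  Adj : (V → V) → EdgeSet → V → V → Set
  Adj part S x y = ∃[ f ] (S f × ((part (src f) ≡ x × part (tgt f) ≡ y)
                                 ⊎ (part (src f) ≡ y × part (tgt f) ≡ x)))

  Connected : (V → V) → EdgeSet → Set
  Connected part S = ∀ (x y : V) → Star (Adj part S) (part x) (part y)

  _∖_ : EdgeSet → E → EdgeSet
  (S ∖ f) g = S g × g ≢ f

  TwoEdgeConnected : (V → V) → EdgeSet → Set
  TwoEdgeConnected part S = Connected part S × (∀ f → S f → Connected part (S ∖ f))

  Cross : (V → V) → E → Set
  Cross part e = part (src e) ≢ part (tgt e)

  cross? : (part : V → V) → (e : E) → Dec (Cross part e)
  cross? part e = ¬? (part (src e) ≟ᶠ part (tgt e))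

  -- State of the grow phase.
  --  part : current partition (node set of F and G')
  --  cost : current costs c'
  --  T    : edges added so far, most recently added first
  -- G is loopless, so the edge set E' of G' is exactly the set of edges
  -- of G crossing the current partition (contraction removes exactly the
  -- edges that become self-loops).  The edges of F are exactly the edges
  -- of T crossing the current partition (edges of contracted cycles
  -- become self-loops in F and are removed).

  record State : Set where
    constructor ⟨_,_,_⟩
    field
      part : V → V
      cost : E → ℚ
      T    : List E
  open State public

  initial : (E → ℚ) → State
  initial c = ⟨ (λ x → x) , c , [] ⟩

  InG' : State → E → Set
  InG' s e = Cross (part s) e

  InF : State → E → Set
  InF s e = e ∈ T s × Cross (part s) e

  degF : State → V → ℕ
  degF s x = length (filter (λ e → cross? (part s) e
                          ×-dec ((part s (src e) ≟ᶠ x) ⊎-dec (part s (tgt e) ≟ᶠ x)))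
                            (T s))

  inL : State → V → Bool
  inL s x with degF s x ℕ.≤? 1
  ... | yes _ = true
  ... | no  _ = false

  b2n : Bool → ℕ
  b2n true  = 1
  b2n false = 0

  ℓ : State → E → ℕ
  ℓ s e = b2n (inL s (part s (src e))) ℕ.+ b2n (inL s (part s (tgt e)))

  Eligible : State → E → Set
  Eligible s e = InG' s e × e ∉ T s × 1 ℕ.≤ ℓ s e

  -- 1/k as a rational (value at k = 0 is irrelevant: only used for ℓ_e ≥ 1)
  inv : ℕ → ℚ
  inv zero    = 0ℚ
  inv (suc k) = + 1 / suc k

  ℕtoℚ : ℕ → ℚ
  ℕtoℚ k = + k / 1

  Δ : State → E → ℚ
  Δ s e = cost s e ℚ.* inv (ℓ s e)

  MoreThanOneNode : State → Set
  MoreThanOneNode s = ∃[ x ] ∃[ y ] (part s x ≢ part s y)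

  OneNode : State → Set
  OneNode s = ∀ x y → part s x ≡ part s y

  FAdj : State → V → V → Set
  FAdj s = Adj (part s) (InF s)

  data FPath (s : State) : V → V → List V → Set where
    here  : ∀ {a} → FPath s a a (a ∷ [])
    there : ∀ {x y b ps} → FAdj s x y → x ∉ ps → FPath s y b ps → FPath s x b (x ∷ ps)

  Step : State → State → Set
  Step s s' =
    MoreThanOneNode s ×
    ∃[ ẽ ] ( Eligible s ẽ
           × (∀ e → Eligible s e → Δ s ẽ ℚ.≤ Δ s e)
           × (∀ e → Eligible s e → cost s' e ≡ cost s e ℚ.- (ℕtoℚ (ℓ s e) ℚ.* Δ s ẽ))
           × (∀ e → ¬ Eligible s e → cost s' e ≡ cost s e)
           × T s' ≡ ẽ ∷ T s
           × let a = part s (src ẽ) ; b = part s (tgt ẽ) in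
             (
               (∃[ ps ] (FPath s a b ps
                 × (∀ w → part s w ∈ ps → part s' w ≡ a)
                 × (∀ w → part s w ∉ ps → part s' w ≡ part s w)))
             ⊎
               ((¬ (∃[ ps ] FPath s a b ps)) × (∀ w → part s' w ≡ part s w))))

  GrowRun : (E → ℚ) → ℕ → (ℕ → State) → Set
  GrowRun c k run = run 0 ≡ initial c
                  × (∀ i → i ℕ.< k → Step (run i) (run (suc i)))
                  × OneNode (run k)

  -- The list to process is T (most recent first = reverse
  -- order of insertion).  Cleanup kept todo result: the current edge set
  -- is todo ∪ kept; process the head e of todo: if (V, current ∖ e) is
  -- 2-edge-connected, drop e, otherwise keep it.
  ListSet : List E → EdgeSet
  ListSet xs e = e ∈ xs

  data Cleanup : List E → List E → List E → Set where
    done : ∀ {kept} → Cleanup kept [] kept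
    drop : ∀ {kept e todo res}
         → TwoEdgeConnected (λ x → x) ((λ f → (f ∈ e ∷ todo ⊎ f ∈ kept)) ∖ e)
         → Cleanup kept todo res → Cleanup kept (e ∷ todo) res
    keep : ∀ {kept e todo res}
         → ¬ TwoEdgeConnected (λ x → x) ((λ f → (f ∈ e ∷ todo ⊎ f ∈ kept)) ∖ e)
         → Cleanup (e ∷ kept) todo res → Cleanup kept (e ∷ todo) res

  Output : State → List E → Set
  Output sk Tbar = Cleanup [] (T sk) Tbar

{-# OPTIONS --safe #-}
-- Throughout the grow phase, for every edge f, any two nodes of G inside a common
-- node of F are joined by edges of T ∖ f: contracting a cycle of F preserves this,
-- since a cycle of F-nodes stays connected after deleting one edge.
-- Let e ∈ T̄^i ∖ E_{F^i}.  Then e ∉ T^i, so e was inserted after step i and the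
-- cleanup examined it before any edge of T^i.  As e survived, the edge set C held
-- at that moment, which contains T̄ and T^i, was not 2-edge-connected without e.
-- Were (V^i, T̄^i ∪ E_{F^i}) ∖ e 2-edge-connected, then paths in it avoiding an edge f
-- could be completed inside the nodes of F^i by edges of T^i ∖ f ⊆ C ∖ {e, f},
-- making C ∖ e 2-edge-connected.
module Submission where

open import Defs
open import Data.Nat using (ℕ; _≤_; zero; suc; _≤′_; ≤′-refl; ≤′-step)
open import Data.Nat.Properties using (≤⇒≤′; <⇒≤; ≤-refl)
open import Data.Fin using (Fin)
open import Data.Fin.Properties using () renaming (_≟_ to _≟ᶠ_)
open import Data.Rational using (ℚ; 0ℚ) renaming (_≤_ to _≤ℚ_)
open import Data.Product using (_×_; _,_; proj₁; ∃-syntax)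
open import Data.Sum using (_⊎_; inj₁; inj₂; [_,_])
open import Data.Unit using (⊤)
open import Data.Empty using (⊥-elim)
open import Data.List using (List; []; _∷_; _++_)
open import Data.List.Membership.Propositional using (_∈_; _∉_)
open import Data.List.Membership.Propositional.Properties using (∈-++⁺ʳ)
open import Data.List.Relation.Unary.Any using (here; there; any?)
open import Function using (id; _∘_)
open import Relation.Nullary using (¬_; yes; no; Dec; _×-dec_; _⊎-dec_; ¬?)
open import Relation.Unary using (_⊆_; _∪_; Decidable)
open import Relation.Binary.PropositionalEquality using (_≡_; refl; sym; trans; subst; cong)
open import Relation.Binary.Construct.Closure.ReflexiveTransitive using (Star; ε; _◅_; _◅◅_; gmap; reverse)

module _ (G : Multigraph) where

  _-_ : EdgeSet G → E G → EdgeSet G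
  _-_ = _∖_ G

  Reach : EdgeSet G → V G → V G → Set
  Reach B = Star (Adj G id B)

  Adj-sym : ∀ {p B x y} → Adj G p B x y → Adj G p B y x
  Adj-sym (f , Bf , inj₁ ends) = f , Bf , inj₂ ends
  Adj-sym (f , Bf , inj₂ ends) = f , Bf , inj₁ ends

  Star-Adj-sym : ∀ {p B x y} → Star (Adj G p B) x y → Star (Adj G p B) y x
  Star-Adj-sym {p} = reverse (Adj-sym {p})

  Star-Adj-mono : ∀ {p A B} → A ⊆ B → ∀ {x y} → Star (Adj G p A) x y → Star (Adj G p B) x y
  Star-Adj-mono A⊆B = gmap id (λ (f , Af , ends) → f , A⊆B Af , ends)

  BlocksConnected : (V G → V G) → EdgeSet G → Set
  BlocksConnected p B = ∀ x y → p x ≡ p y → Reach B x y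

  BlocksConnected-mono : ∀ {p A B} → A ⊆ B → BlocksConnected p A → BlocksConnected p B
  BlocksConnected-mono A⊆B blocks x y eq = Star-Adj-mono {id} A⊆B (blocks x y eq)

  Star-uncontract : ∀ {p A B} → A ⊆ B → BlocksConnected p B →
                    ∀ {a b} → Star (Adj G p A) a b → ∀ {x y} → p x ≡ a → p y ≡ b → Reach B x y
  Star-uncontract A⊆B blocks ε {x} {y} px py = blocks x y (trans px (sym py))
  Star-uncontract A⊆B blocks ((f , Af , inj₁ (fa , fb)) ◅ path) {x} px py =
    blocks x (src G f) (trans px (sym fa))
      ◅◅ (f , A⊆B Af , inj₁ (refl , refl)) ◅ Star-uncontract A⊆B blocks path fb py
  Star-uncontract A⊆B blocks ((f , Af , inj₂ (fb , fa)) ◅ path) {x} px py =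
    blocks x (tgt G f) (trans px (sym fa))
      ◅◅ (f , A⊆B Af , inj₂ (refl , refl)) ◅ Star-uncontract A⊆B blocks path fb py

  Connected-uncontract : ∀ {p A B} → A ⊆ B → BlocksConnected p B → Connected G p A → Connected G id B
  Connected-uncontract A⊆B blocks conn x y = Star-uncontract A⊆B blocks (conn x y) refl refl

  TwoEdgeConnected-uncontract : ∀ {p A B} → Decidable A → A ⊆ B →
                                BlocksConnected p B → (∀ f → BlocksConnected p (B - f)) →
                                TwoEdgeConnected G p A → TwoEdgeConnected G id B
  TwoEdgeConnected-uncontract {A = A} {B} A? A⊆B blocks blocks∖ (conn , conn∖) =
    Connected-uncontract A⊆B blocks conn , λ f _ → without f (A? f)
    where
      without : ∀ f → Dec (A f) → Connected G id (B - f)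
      without f (yes Af) = Connected-uncontract (λ (Ag , g≢f) → A⊆B Ag , g≢f) (blocks∖ f) (conn∖ f Af)
      without f (no ¬Af) = Connected-uncontract (λ Ag → A⊆B Ag , λ { refl → ¬Af Ag }) (blocks∖ f) conn

  edgesOf : ∀ {s a b ps} → FPath G s a b ps → List (E G)
  edgesOf here                = []
  edgesOf (there (g , _) _ P) = g ∷ edgesOf P

  edgesOf⊆T : ∀ {s a b ps} (P : FPath G s a b ps) → ListSet G (edgesOf P) ⊆ ListSet G (T s)
  edgesOf⊆T (there (g , (g∈T , _) , _) _ P) (here refl) = g∈T
  edgesOf⊆T (there _ _ P)                   (there g∈P) = edgesOf⊆T P g∈P

  head∈ : ∀ {s a b ps} → FPath G s a b ps → a ∈ ps
  head∈ here          = here refl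
  head∈ (there _ _ _) = here refl

  last∈ : ∀ {s a b ps} → FPath G s a b ps → b ∈ ps
  last∈ here          = here refl
  last∈ (there _ _ P) = there (last∈ P)

  endpoint-∈ : ∀ {p : V G → V G} {g x y} {ps : List (V G)} →
               (p (src G g) ≡ x × p (tgt G g) ≡ y) ⊎ (p (src G g) ≡ y × p (tgt G g) ≡ x) →
               p (src G g) ∈ ps × p (tgt G g) ∈ ps → x ∈ ps
  endpoint-∈ (inj₁ (refl , _)) (src∈ , _) = src∈
  endpoint-∈ (inj₂ (_ , refl)) (_ , tgt∈) = tgt∈

  edgesOf-ends : ∀ {s a b ps g} (P : FPath G s a b ps) → g ∈ edgesOf P →
                 part s (src G g) ∈ ps × part s (tgt G g) ∈ ps
  edgesOf-ends (there (_ , _ , inj₁ (refl , refl)) _ P) (here refl) = here refl , there (head∈ P)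
  edgesOf-ends (there (_ , _ , inj₂ (refl , refl)) _ P) (here refl) = there (head∈ P) , here refl
  edgesOf-ends (there _ _ P) (there g∈P) =
    let src∈ , tgt∈ = edgesOf-ends P g∈P in there src∈ , there tgt∈

  module _ {s : State G} {B : EdgeSet G} (T⊆B : ListSet G (T s) ⊆ B) where

    Linked : E G → V G → V G → Set
    Linked f = Star (Adj G (part s) (B - f))

    path-avoiding : ∀ {a b ps f w} (P : FPath G s a b ps) → f ∉ edgesOf P → w ∈ ps → Linked f w a
    path-avoiding here                _  (here refl) = ε
    path-avoiding (there _ _ _)       _  (here refl) = ε
    path-avoiding (there (g , (g∈T , _) , ends) _ P) f∉ (there w∈) =
      path-avoiding P (f∉ ∘ there) w∈
        ◅◅ Adj-sym {part s} (g , (T⊆B g∈T , λ { refl → f∉ (here refl) }) , ends) ◅ ε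

    path-split : ∀ {a b ps w} (P : FPath G s a b ps) f → w ∈ ps → Linked f w a ⊎ Linked f w b
    path-split here          _ (here refl) = inj₁ ε
    path-split (there _ _ _) _ (here refl) = inj₁ ε
    path-split (there (g , (g∈T , _) , ends) a∉ P) f (there w∈) with g ≟ᶠ f
    ... | yes refl = inj₂ (path-avoiding P g∉P w∈ ◅◅ Star-Adj-sym {part s} (path-avoiding P g∉P (last∈ P)))
      where
        -- P is simple, so its first edge has an endpoint off the rest of P.
        g∉P : g ∉ edgesOf P
        g∉P g∈P = a∉ (endpoint-∈ {part s} ends (edgesOf-ends P g∈P))
    ... | no g≢f   = [ inj₁ ∘ (_◅◅ Adj-sym {part s} (g , (T⊆B g∈T , g≢f) , ends) ◅ ε) , inj₂ ]
                       (path-split P f w∈)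

    cycle-linked : ∀ {ẽ ps w} → ẽ ∉ T s → B ẽ →
                   FPath G s (part s (src G ẽ)) (part s (tgt G ẽ)) ps →
                   ∀ f → w ∈ ps → Linked f w (part s (src G ẽ))
    cycle-linked {ẽ} ẽ∉T Bẽ P f w∈ with ẽ ≟ᶠ f
    ... | yes refl = path-avoiding P (ẽ∉T ∘ edgesOf⊆T P) w∈
    ... | no ẽ≢f   = [ id , _◅◅ (ẽ , (Bẽ , ẽ≢f) , inj₂ (refl , refl)) ◅ ε ] (path-split P f w∈)

  BlocksTwoEdgeConnected : State G → Set
  BlocksTwoEdgeConnected s = ∀ f → BlocksConnected (part s) (ListSet G (T s) - f)

  initial-blocks : ∀ c → BlocksTwoEdgeConnected (initial G c)
  initial-blocks c f x .x refl = ε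

  module _ {s s′ : State G} {ẽ : E G} (T≡ : T s′ ≡ ẽ ∷ T s) (blocks : BlocksTwoEdgeConnected s) where

    T⊆T′ : ListSet G (T s) ⊆ ListSet G (T s′)
    T⊆T′ g∈T = subst (_ ∈_) (sym T≡) (there g∈T)

    T-grows : ∀ f → ListSet G (T s) - f ⊆ ListSet G (T s′) - f
    T-grows f (g∈T , g≢f) = T⊆T′ g∈T , g≢f

    blocks-unchanged : (∀ w → part s′ w ≡ part s w) → BlocksTwoEdgeConnected s′
    blocks-unchanged same f x y eq =
      Star-Adj-mono {id} (T-grows f) (blocks f x y (trans (sym (same x)) (trans eq (same y))))

    module _ (ẽ∉T : ẽ ∉ T s) {ps} (P : FPath G s (part s (src G ẽ)) (part s (tgt G ẽ)) ps)
             (inside  : ∀ w → part s w ∈ ps → part s′ w ≡ part s (src G ẽ))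
             (outside : ∀ w → part s w ∉ ps → part s′ w ≡ part s w) where

      contracted⇒on-cycle : ∀ {z} → part s′ z ≡ part s (src G ẽ) → part s z ∈ ps
      contracted⇒on-cycle {z} z↦ẽ with any? (part s z ≟ᶠ_) ps
      ... | yes z∈ = z∈
      ... | no  z∉ = subst (_∈ ps) (trans (sym z↦ẽ) (outside z z∉)) (head∈ P)

      on-cycle : ∀ f {z} → part s z ∈ ps → Reach (ListSet G (T s′) - f) z (src G ẽ)
      on-cycle f z∈ =
        Star-uncontract {part s} id (BlocksConnected-mono (T-grows f) (blocks f))
          (cycle-linked T⊆T′ ẽ∉T (subst (ẽ ∈_) (sym T≡) (here refl)) P f z∈)
          refl refl

      blocks-contract : BlocksTwoEdgeConnected s′
      blocks-contract f x y eq with any? (part s x ≟ᶠ_) ps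
      ... | yes x∈ =
        on-cycle f x∈ ◅◅ Star-Adj-sym {id} (on-cycle f (contracted⇒on-cycle (trans (sym eq) (inside x x∈))))
      ... | no  x∉ =
        Star-Adj-mono {id} (T-grows f) (blocks f x y (trans (sym (outside x x∉)) (trans eq (outside y y∉))))
        where
          y∉ : part s y ∉ ps
          y∉ y∈ = x∉ (contracted⇒on-cycle (trans eq (inside y y∈)))

  step-blocks : ∀ {s s′} → Step G s s′ → BlocksTwoEdgeConnected s → BlocksTwoEdgeConnected s′
  step-blocks {s} {s′} (_ , _ , _ , _ , _ , _ , T≡ , inj₂ (_ , same)) blocks =
    blocks-unchanged {s} {s′} T≡ blocks same
  step-blocks {s} {s′} (_ , _ , (_ , ẽ∉T , _) , _ , _ , _ , T≡ , inj₁ (_ , P , inside , outside)) blocks =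
    blocks-contract {s} {s′} T≡ blocks ẽ∉T P inside outside

  run-blocks : ∀ {c k run} → GrowRun G c k run → ∀ j → j ≤ k → BlocksTwoEdgeConnected (run j)
  run-blocks {c} (run0 , _ , _) zero _ = subst BlocksTwoEdgeConnected (sym run0) (initial-blocks c)
  run-blocks gr@(_ , steps , _) (suc j) j<k = step-blocks (steps j j<k) (run-blocks gr j (<⇒≤ j<k))

  step-T : ∀ {s s′} → Step G s s′ → ∃[ ẽ ] T s′ ≡ ẽ ∷ T s
  step-T (_ , ẽ , _ , _ , _ , _ , T≡ , _) = ẽ , T≡

  run-T-prefix : ∀ {c k run i j} → GrowRun G c k run → i ≤′ j → j ≤ k →
                 ∃[ X ] T (run j) ≡ X ++ T (run i)
  run-T-prefix _ ≤′-refl _ = [] , refl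
  run-T-prefix {run = run} gr@(_ , steps , _) (≤′-step {j} i≤′j) j<k =
    let ẽ , T≡ = step-T {run j} {run (suc j)} (steps j j<k)
        X , T≡X++ = run-T-prefix gr i≤′j (<⇒≤ j<k)
    in ẽ ∷ X , trans T≡ (cong (ẽ ∷_) T≡X++)

  Cleanup-⊆ : ∀ {kept todo res} → Cleanup G kept todo res → ListSet G res ⊆ ListSet G todo ∪ ListSet G kept
  Cleanup-⊆ done              e∈ = inj₂ e∈
  Cleanup-⊆ (drop _ cleanup) e∈ with Cleanup-⊆ cleanup e∈
  ... | inj₁ e∈todo         = inj₁ (there e∈todo)
  ... | inj₂ e∈kept         = inj₂ e∈kept
  Cleanup-⊆ (keep _ cleanup) e∈ with Cleanup-⊆ cleanup e∈
  ... | inj₁ e∈todo         = inj₁ (there e∈todo)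
  ... | inj₂ (here refl)    = inj₁ (here refl)
  ... | inj₂ (there e∈kept) = inj₂ e∈kept

  cleanup-keeps : ∀ X {Y kept res e} → Cleanup G kept (X ++ Y) res → e ∈ res → e ∉ Y → e ∉ kept →
                  ∃[ C ] (¬ TwoEdgeConnected G id (C - e) × ListSet G res ⊆ C × ListSet G Y ⊆ C)
  cleanup-keeps []      cleanup e∈ e∉Y e∉kept = ⊥-elim ([ e∉Y , e∉kept ] (Cleanup-⊆ cleanup e∈))
  cleanup-keeps (_ ∷ X) (drop _ cleanup) e∈ e∉Y e∉kept = cleanup-keeps X cleanup e∈ e∉Y e∉kept
  cleanup-keeps (x ∷ X) {e = e} (keep ¬tec cleanup) e∈ e∉Y e∉kept with x ≟ᶠ e
  ... | yes refl = _ , ¬tec , Cleanup-⊆ (keep ¬tec cleanup) , inj₁ ∘ there ∘ ∈-++⁺ʳ X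
  ... | no x≢e = cleanup-keeps X cleanup e∈ e∉Y λ { (here refl) → x≢e refl ; (there e∈kept) → e∉kept e∈kept }

  TwoEdgeConnected-∖-uncontract : ∀ {p Y C S e} → (∀ f → BlocksConnected p (ListSet G Y - f)) →
                                  e ∉ Y → ListSet G Y ⊆ C → S ⊆ C → Decidable S →
                                  TwoEdgeConnected G p (S - e) → TwoEdgeConnected G id (C - e)
  TwoEdgeConnected-∖-uncontract {Y = Y} {C} {S} {e} blocks e∉Y Y⊆C S⊆C S? =
    TwoEdgeConnected-uncontract S∖e? (λ (Sf , f≢e) → S⊆C Sf , f≢e)
      (BlocksConnected-mono Y∖f⊆ (blocks e))
      (λ f → BlocksConnected-mono (λ (g∈Y , g≢f) → Y∖f⊆ (g∈Y , λ { refl → e∉Y g∈Y }) , g≢f) (blocks f))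
    where
      S∖e? : Decidable (S - e)
      S∖e? f = S? f ×-dec ¬? (f ≟ᶠ e)
      Y∖f⊆ : ∀ {f} → ListSet G Y - f ⊆ C - f
      Y∖f⊆ (g∈Y , g≢f) = Y⊆C g∈Y , g≢f

lemma5 : (G : Multigraph) → Loopless G
    → TwoEdgeConnected G (λ x → x) (λ _ → ⊤)
    → (c : Fin (Multigraph.m G) → ℚ) → (∀ e → 0ℚ ≤ℚ c e)
    → (k : ℕ) (run : ℕ → State G) → GrowRun G c k run
    → (Tbar : List (Fin (Multigraph.m G))) → Output G (run k) Tbar
    → (i : ℕ) → i ≤ k
    → (e : Fin (Multigraph.m G))
    → (e ∈ Tbar × Cross G (part (run i)) e)
    → ¬ InF G (run i) e
    → ¬ TwoEdgeConnected G (part (run i))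
          (_∖_ G (λ f → (f ∈ Tbar × Cross G (part (run i)) f) ⊎ InF G (run i) f) e)
lemma5 G _ _ _ _ _ run gr Tbar out i i≤k e (e∈Tbar , e-cross) e∉F =
  let X , T≡ = run-T-prefix G gr (≤⇒≤′ i≤k) ≤-refl
      _ , ¬tec , Tbar⊆C , Tᵢ⊆C =
        cleanup-keeps G X (subst (λ L → Cleanup G [] L Tbar) T≡ out) e∈Tbar e∉Tᵢ λ ()
  in ¬tec ∘ TwoEdgeConnected-∖-uncontract G (run-blocks G gr i i≤k) e∉Tᵢ Tᵢ⊆C
              [ Tbar⊆C ∘ proj₁ , Tᵢ⊆C ∘ proj₁ ] S?
  where
    e∉Tᵢ : e ∉ T (run i)
    e∉Tᵢ e∈Tᵢ = e∉F (e∈Tᵢ , e-cross)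
    S? : Decidable (λ f → (f ∈ Tbar × Cross G (part (run i)) f) ⊎ InF G (run i) f)
    S? f = (any? (f ≟ᶠ_) Tbar ×-dec cross? G (part (run i)) f)
           ⊎-dec (any? (f ≟ᶠ_) (T (run i)) ×-dec cross? G (part (run i)) f)
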